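{- Let $G=(V,E,w)$ be a finite simple undirected graph with positive vertex weights containing a path $v_1v_2v_3v_4$ (four distinct vertices) such that $d_G(v_2)=d_G(v_3)=2$ and $w(v_1)\ge w(v_2)\ge w(v_3)\ge w(v_4)$. Let $G'$ be the weighted graph obtained from $G$ by deleting $v_2$ and $v_3$, adding the edge $v_1v_4$ if it does not already exist, and changing the weight of $v_1$ to $w(v_1)+w(v_3)-w(v_2)$ (all other weights unchanged). Then $\alpha(G)=\alpha(G')+w(v_2)$.
   Context: $\alpha(H)$ denotes the maximum total vertex weight of an independent set in the weighted graph $H$; $d_G(v)$ is the degree of $v$ in $G$.
   Formalization: The vertex weights take values in the positive rationals. -}

module Defs where

open import Data.Bool using (Bool; true; false; _∧_; _∨_; not; if_then_else_)
open import Data.Nat using (ℕ; zero; suc)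
open import Data.Fin using (Fin; zero; suc)
open import Data.Fin.Properties using (_≟_)
open import Data.Vec using (Vec; []; _∷_; lookup)
open import Data.List using (List; []; _∷_; map; _++_; foldr; filter; allFin; length)
open import Data.Rational using (ℚ; 0ℚ; _+_; _-_; _⊔_; _<_)
open import Relation.Nullary.Decidable using (⌊_⌋)
open import Relation.Binary.PropositionalEquality using (_≡_)

record SimpleGraph (n : ℕ) : Set where
  field
    adj   : Fin n → Fin n → Bool
    sym   : ∀ x y → adj x y ≡ adj y x
    irrfl : ∀ x → adj x x ≡ false
open SimpleGraph public

Subset : ℕ → Set
Subset n = Vec Bool n

subsets : (n : ℕ) → List (Subset n)
subsets zero    = [] ∷ []
subsets (suc n) = map (true ∷_) (subsets n) ++ map (false ∷_) (subsets n)

_=ᵇ_ : ∀ {n} → Fin n → Fin n → Bool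
x =ᵇ y = ⌊ x ≟ y ⌋

allᵇ : ∀ {A : Set} → (A → Bool) → List A → Bool
allᵇ p = foldr (λ a b → p a ∧ b) true

degree : ∀ {n} → (Fin n → Fin n → Bool) → Fin n → ℕ
degree {n} adj v = length (filter (λ u → adj v u Data.Bool.≟ true) (allFin n))

-- A weighted graph with vertex set U ⊆ Fin n (vertices outside U are
-- not part of the graph), adjacency relation `adj` and weights `w`.
isIndepᵇ : ∀ {n} → (U : Subset n) → (Fin n → Fin n → Bool) → Subset n → Bool
isIndepᵇ {n} U adj S =
  allᵇ (λ x → not (lookup S x) ∨ lookup U x) (allFin n) ∧
  allᵇ (λ x → allᵇ (λ y → not (lookup S x ∧ lookup S y ∧ adj x y)) (allFin n)) (allFin n)

weight : ∀ {n} → (Fin n → ℚ) → Subset n → ℚ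
weight {n} w S = foldr (λ x acc → (if lookup S x then w x else 0ℚ) + acc) 0ℚ (allFin n)

-- α: maximum total weight of an independent set (the empty set is
-- independent, so starting the maximum at 0 is harmless for nonnegative weights
-- and the value is attained).
α : ∀ {n} → (U : Subset n) → (Fin n → Fin n → Bool) → (Fin n → ℚ) → ℚ
α {n} U adj w =
  foldr _⊔_ 0ℚ (map (weight w) (filter (λ S → isIndepᵇ U adj S Data.Bool.≟ true) (subsets n)))

full : ∀ {n} → Subset n
full {zero}  = []
full {suc n} = true ∷ full

removeTwo : ∀ {n} → Fin n → Fin n → Subset n
removeTwo {n} a b = Data.Vec.tabulate (λ x → not (x =ᵇ a ∨ x =ᵇ b))

addEdge : ∀ {n} → (Fin n → Fin n → Bool) → Fin n → Fin n → (Fin n → Fin n → Bool)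
addEdge adj a b x y = adj x y ∨ (x =ᵇ a ∧ y =ᵇ b) ∨ (x =ᵇ b ∧ y =ᵇ a)

newWeight : ∀ {n} → (Fin n → ℚ) → Fin n → Fin n → Fin n → (Fin n → ℚ)
newWeight w v₁ v₂ v₃ x = if x =ᵇ v₁ then w v₁ + w v₃ - w v₂ else w x

-- Optimal independent sets of G and G′ differ only on the path.  An independent set S
-- of G contains at most one end of v₂v₃ (if v₁ ∉ S) or of v₃v₄ (if v₁ ∈ S); deleting
-- both ends loses at most w(v₂), resp. w(v₃), and when v₁ ∈ S the new weight
-- w(v₁) + w(v₃) − w(v₂) turns the loss w(v₃) into w(v₂).  Conversely an independent
-- set T of G′ avoids v₂ and v₃; as these have degree two, T extends by v₃ if v₁ ∈ T
-- (then v₄ ∉ T because of the new edge v₁v₄) and by v₂ otherwise, gaining exactly w(v₂).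
module Submission where

open import Defs
open import Data.Nat using (ℕ)
open import Data.Fin using (Fin)
open import Data.Bool using (true)
open import Data.Rational using (ℚ; 0ℚ; _<_; _≤_; _+_)
open import Relation.Binary.PropositionalEquality using (_≡_; _≢_)

open import Data.Bool using (Bool; false; not; _∧_; _∨_; if_then_else_)
import Data.Bool as Bool
open import Data.Bool.Properties using (not-¬; ¬-not; ∨-zeroʳ; ∨-conicalˡ)
open import Data.Empty using (⊥-elim)
open import Data.Fin using (zero; suc)
open import Data.Fin.Properties using (_≟_; suc-injective)
open import Data.List as List using (List; []; _∷_; length; map; filter; allFin)
open import Data.List.Membership.Propositional using (_∈_)
open import Data.List.Membership.Propositional.Properties
  using (∈-filter⁺; ∈-filter⁻; ∈-map⁺; ∈-map⁻; ∈-++⁺ˡ; ∈-++⁺ʳ; ∈-allFin)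
open import Data.List.Relation.Unary.Any using (here; there)
open import Data.Product using (_×_; _,_; proj₁; proj₂; ∃-syntax)
open import Data.Rational using (_-_; _⊔_)
open import Data.Rational.Properties
  using (+-0-monoid; +-identityˡ; +-identityʳ; +-assoc; +-monoˡ-≤; +-monoʳ-≤; ≤-reflexive; ≤-trans; ≤-antisym;
         <⇒≤; ⊔-sel; p≤p⊔q; p≤q⊔p; module ≤-Reasoning)
open import Data.Rational.Solver using (module +-*-Solver)
open import Data.Sum using (_⊎_; inj₁; inj₂; swap)
open import Data.Vec as Vec using (lookup; replicate; _[_]≔_)
open import Data.Vec.Functional using (Vector)
open import Data.Vec.Properties using (lookup∘updateAt; lookup∘updateAt′; lookup∘tabulate; lookup-replicate)
open import Function using (_∘_; id)
import Relation.Binary.PropositionalEquality as ≡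
open ≡ using (refl; trans; cong; cong₂; subst₂)
open import Relation.Nullary using (Dec; yes; no)
open import Relation.Nullary.Decidable using (isYes≗does; dec-true; dec-false)

open import Algebra.Properties.Monoid.Sum +-0-monoid using (sum; sum-cong-≗; sum-replicate-zero)
open +-*-Solver using (solve; _:+_; _:-_; _:=_)

=ᵇ-refl : ∀ {n} (x : Fin n) → x =ᵇ x ≡ true
=ᵇ-refl x = trans (isYes≗does (x ≟ x)) (dec-true (x ≟ x) refl)

=ᵇ-≢ : ∀ {n} {x y : Fin n} → x ≢ y → x =ᵇ y ≡ false
=ᵇ-≢ {x = x} {y} x≢y = trans (isYes≗does (x ≟ y)) (dec-false (x ≟ y) x≢y)

lookup-[]≔-≢ : ∀ {n} (S : Subset n) {v x : Fin n} {b : Bool} → x ≢ v → lookup (S [ v ]≔ b) x ≡ lookup S x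
lookup-[]≔-≢ S {v} {x} x≢v = lookup∘updateAt′ x v x≢v S

lookup-[]≔ : ∀ {n} (S : Subset n) (v : Fin n) {b : Bool} → lookup (S [ v ]≔ b) v ≡ b
lookup-[]≔ S v = lookup∘updateAt v S

foldr-tabulate : ∀ {A : Set} {n} (f : A → ℚ) (g : Fin n → A) →
                 List.foldr (λ x acc → f x + acc) 0ℚ (List.tabulate g) ≡ sum (f ∘ g)
foldr-tabulate {n = ℕ.zero}  f g = refl
foldr-tabulate {n = ℕ.suc n} f g = cong (f (g zero) +_) (foldr-tabulate f (g ∘ suc))

sum-agree-except : ∀ {n} (v : Fin n) {f g : Vector ℚ n} → (∀ x → x ≢ v → f x ≡ g x) →
                   sum f + g v ≡ sum g + f v
sum-agree-except zero {f} {g} f≗g = begin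
  (f zero + sum (f ∘ suc)) + g zero  ≡⟨ cong (λ s → (f zero + s) + g zero) tails-agree ⟩
  (f zero + sum (g ∘ suc)) + g zero  ≡⟨ exchange (f zero) (sum (g ∘ suc)) (g zero) ⟩
  (g zero + sum (g ∘ suc)) + f zero  ∎
  where
  open ≡.≡-Reasoning
  tails-agree : sum (f ∘ suc) ≡ sum (g ∘ suc)
  tails-agree = sum-cong-≗ λ x → f≗g (suc x) λ ()
  exchange : ∀ a s b → (a + s) + b ≡ (b + s) + a
  exchange = solve 3 (λ a s b → (a :+ s) :+ b := (b :+ s) :+ a) refl
sum-agree-except (suc v) {f} {g} f≗g = begin
  (f zero + sum (f ∘ suc)) + g (suc v)  ≡⟨ +-assoc (f zero) _ _ ⟩
  f zero + (sum (f ∘ suc) + g (suc v))  ≡⟨ cong₂ _+_ (f≗g zero λ ()) (sum-agree-except v tails-agree) ⟩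
  g zero + (sum (g ∘ suc) + f (suc v))  ≡⟨ +-assoc (g zero) _ _ ⟨
  (g zero + sum (g ∘ suc)) + f (suc v)  ∎
  where
  open ≡.≡-Reasoning
  tails-agree : ∀ x → x ≢ v → f (suc x) ≡ g (suc x)
  tails-agree x x≢v = f≗g (suc x) (x≢v ∘ suc-injective)

contribution : ∀ {n} → (Fin n → ℚ) → Subset n → Fin n → ℚ
contribution w S x = if lookup S x then w x else 0ℚ

contribution-∈ : ∀ {n} (w : Fin n → ℚ) (S : Subset n) {x : Fin n} → lookup S x ≡ true → contribution w S x ≡ w x
contribution-∈ w S {x} x∈ = cong (λ b → if b then w x else 0ℚ) x∈

contribution-∉ : ∀ {n} (w : Fin n → ℚ) (S : Subset n) {x : Fin n} → lookup S x ≡ false → contribution w S x ≡ 0ℚ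
contribution-∉ w S {x} x∉ = cong (λ b → if b then w x else 0ℚ) x∉

weight≡sum : ∀ {n} (w : Fin n → ℚ) (S : Subset n) → weight w S ≡ sum (contribution w S)
weight≡sum w S = foldr-tabulate (contribution w S) id

weight-agree-except : ∀ {n} (w : Fin n → ℚ) (S : Subset n) (w′ : Fin n → ℚ) (S′ : Subset n) (v : Fin n) →
                      (∀ x → x ≢ v → contribution w S x ≡ contribution w′ S′ x) →
                      weight w S + contribution w′ S′ v ≡ weight w′ S′ + contribution w S v
weight-agree-except w S w′ S′ v agree =
  subst₂ (λ a b → a + contribution w′ S′ v ≡ b + contribution w S v)
         (≡.sym (weight≡sum w S)) (≡.sym (weight≡sum w′ S′)) (sum-agree-except v agree)

weight-[]≔ : ∀ {n} (w : Fin n → ℚ) (S : Subset n) (v : Fin n) (b : Bool) →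
             weight w (S [ v ]≔ b) + contribution w S v ≡ weight w S + (if b then w v else 0ℚ)
weight-[]≔ w S v b =
  trans (weight-agree-except w (S [ v ]≔ b) w S v agree)
        (cong (λ c → weight w S + (if c then w v else 0ℚ)) (lookup-[]≔ S v))
  where
  agree : ∀ x → x ≢ v → contribution w (S [ v ]≔ b) x ≡ contribution w S x
  agree x x≢v = cong (λ c → if c then w x else 0ℚ) (lookup-[]≔-≢ S x≢v)

weight-insert : ∀ {n} (w : Fin n → ℚ) (S : Subset n) {v : Fin n} → lookup S v ≡ false →
                weight w (S [ v ]≔ true) ≡ weight w S + w v
weight-insert w S {v} v∉S = begin
  weight w (S [ v ]≔ true)                        ≡⟨ +-identityʳ _ ⟨
  weight w (S [ v ]≔ true) + 0ℚ                   ≡⟨ cong (weight w (S [ v ]≔ true) +_) (contribution-∉ w S v∉S) ⟨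
  weight w (S [ v ]≔ true) + contribution w S v   ≡⟨ weight-[]≔ w S v true ⟩
  weight w S + w v                                ∎
  where open ≡.≡-Reasoning

weight-remove : ∀ {n} (w : Fin n → ℚ) (S : Subset n) (v : Fin n) →
                weight w S ≡ weight w (S [ v ]≔ false) + contribution w S v
weight-remove w S v = ≡.sym (trans (weight-[]≔ w S v false) (+-identityʳ (weight w S)))

weight-reweight : ∀ {n} (w w′ : Fin n → ℚ) (S : Subset n) (v : Fin n) → (∀ x → x ≢ v → w x ≡ w′ x) →
                  weight w′ S + contribution w S v ≡ weight w S + contribution w′ S v
weight-reweight w w′ S v w≗w′ =
  weight-agree-except w′ S w S v λ x x≢v → cong (λ q → if lookup S x then q else 0ℚ) (≡.sym (w≗w′ x x≢v))

weight-empty : ∀ {n} (w : Fin n → ℚ) → weight w (replicate n false) ≡ 0ℚ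
weight-empty {n} w = begin
  weight w (replicate n false)             ≡⟨ weight≡sum w (replicate n false) ⟩
  sum (contribution w (replicate n false))  ≡⟨ sum-cong-≗ nothing-contributes ⟩
  sum {n} (λ _ → 0ℚ)                       ≡⟨ sum-replicate-zero n ⟩
  0ℚ                                       ∎
  where
  open ≡.≡-Reasoning
  nothing-contributes : ∀ x → contribution w (replicate n false) x ≡ 0ℚ
  nothing-contributes x = contribution-∉ w (replicate n false) (lookup-replicate x false)

module _ {n} (w : Fin n → ℚ) (v₁ v₂ v₃ : Fin n) (S : Subset n) where

  private
    w′ : Fin n → ℚ
    w′ = newWeight w v₁ v₂ v₃

    w≗w′ : ∀ x → x ≢ v₁ → w x ≡ w′ x
    w≗w′ x x≢v₁ = ≡.sym (cong (λ b → if b then w v₁ + w v₃ - w v₂ else w x) (=ᵇ-≢ x≢v₁))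

    w′-v₁ : w′ v₁ ≡ w v₁ + w v₃ - w v₂
    w′-v₁ = cong (λ b → if b then w v₁ + w v₃ - w v₂ else w v₁) (=ᵇ-refl v₁)

  weight-newWeight-∉ : lookup S v₁ ≡ false → weight w′ S ≡ weight w S
  weight-newWeight-∉ v₁∉S = begin
    weight w′ S                       ≡⟨ +-identityʳ _ ⟨
    weight w′ S + 0ℚ                  ≡⟨ cong (weight w′ S +_) (contribution-∉ w S v₁∉S) ⟨
    weight w′ S + contribution w S v₁  ≡⟨ weight-reweight w w′ S v₁ w≗w′ ⟩
    weight w S + contribution w′ S v₁  ≡⟨ cong (weight w S +_) (contribution-∉ w′ S v₁∉S) ⟩
    weight w S + 0ℚ                   ≡⟨ +-identityʳ _ ⟩
    weight w S                        ∎
    where open ≡.≡-Reasoning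

  weight-newWeight-∈ : lookup S v₁ ≡ true → weight w′ S + w v₂ ≡ weight w S + w v₃
  weight-newWeight-∈ v₁∈S = begin
    weight w′ S + w v₂                                  ≡⟨ add-and-subtract (weight w′ S) (w v₁) (w v₂) ⟩
    (weight w′ S + w v₁) + (w v₂ - w v₁)                ≡⟨ cong (_+ (w v₂ - w v₁)) reweighted ⟩
    (weight w S + (w v₁ + w v₃ - w v₂)) + (w v₂ - w v₁) ≡⟨ cancel (weight w S) (w v₁) (w v₂) (w v₃) ⟩
    weight w S + w v₃                                   ∎
    where
    open ≡.≡-Reasoning
    add-and-subtract : ∀ a p q → a + q ≡ (a + p) + (q - p)
    add-and-subtract = solve 3 (λ a p q → a :+ q := (a :+ p) :+ (q :- p)) refl
    cancel : ∀ a p q r → (a + (p + r - q)) + (q - p) ≡ a + r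
    cancel = solve 4 (λ a p q r → (a :+ (p :+ r :- q)) :+ (q :- p) := a :+ r) refl
    reweighted : weight w′ S + w v₁ ≡ weight w S + (w v₁ + w v₃ - w v₂)
    reweighted = begin
      weight w′ S + w v₁                ≡⟨ cong (weight w′ S +_) (contribution-∈ w S v₁∈S) ⟨
      weight w′ S + contribution w S v₁  ≡⟨ weight-reweight w w′ S v₁ w≗w′ ⟩
      weight w S + contribution w′ S v₁  ≡⟨ cong (weight w S +_) (contribution-∈ w′ S v₁∈S) ⟩
      weight w S + w′ v₁                ≡⟨ cong (weight w S +_) w′-v₁ ⟩
      weight w S + (w v₁ + w v₃ - w v₂) ∎

-- _⊆_ and Stable are records rather than Π-types so that Agda can infer the sets from a proof.
infix 4 _⊆_

record _⊆_ {n} (S T : Subset n) : Set where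
  constructor mk⊆
  field include : ∀ {x} → lookup S x ≡ true → lookup T x ≡ true
open _⊆_

⊆-trans : ∀ {n} {S T U : Subset n} → S ⊆ T → T ⊆ U → S ⊆ U
⊆-trans S⊆T T⊆U = mk⊆ λ x∈S → include T⊆U (include S⊆T x∈S)

⊆-∉ : ∀ {n} {S T : Subset n} {x : Fin n} → S ⊆ T → lookup T x ≡ false → lookup S x ≡ false
⊆-∉ S⊆T x∉T = ¬-not λ x∈S → not-¬ x∉T (include S⊆T x∈S)

[]≔false-⊆ : ∀ {n} (S : Subset n) (v : Fin n) → S [ v ]≔ false ⊆ S
[]≔false-⊆ S v = mk⊆ kept
  where
  kept : ∀ {x} → lookup (S [ v ]≔ false) x ≡ true → lookup S x ≡ true
  kept {x} x∈ with x ≟ v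
  ... | yes refl = ⊥-elim (not-¬ (lookup-[]≔ S v) x∈)
  ... | no x≢v   = trans (≡.sym (lookup-[]≔-≢ S x≢v)) x∈

⊆-full : ∀ {n} {S : Subset n} → S ⊆ full
⊆-full = mk⊆ λ {x} _ → full-true x
  where
  full-true : ∀ {n} (x : Fin n) → lookup full x ≡ true
  full-true zero    = refl
  full-true (suc x) = full-true x

⊆-removeTwo : ∀ {n} {S : Subset n} {a b : Fin n} → lookup S a ≡ false → lookup S b ≡ false → S ⊆ removeTwo a b
⊆-removeTwo {S = S} {a} {b} a∉S b∉S = mk⊆ λ {x} x∈S →
  trans (lookup∘tabulate (λ y → not (y =ᵇ a ∨ y =ᵇ b)) x)
        (cong₂ (λ p q → not (p ∨ q)) (=ᵇ-≢ (≢-∉ x∈S a∉S)) (=ᵇ-≢ (≢-∉ x∈S b∉S)))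
  where
  ≢-∉ : ∀ {x c} → lookup S x ≡ true → lookup S c ≡ false → x ≢ c
  ≢-∉ x∈S c∉S refl = not-¬ c∉S x∈S

removeTwo-∌ˡ : ∀ {n} (a b : Fin n) → lookup (removeTwo a b) a ≡ false
removeTwo-∌ˡ a b rewrite lookup∘tabulate (λ y → not (y =ᵇ a ∨ y =ᵇ b)) a | =ᵇ-refl a = refl

removeTwo-∌ʳ : ∀ {n} (a b : Fin n) → lookup (removeTwo a b) b ≡ false
removeTwo-∌ʳ a b rewrite lookup∘tabulate (λ y → not (y =ᵇ a ∨ y =ᵇ b)) b | =ᵇ-refl b | ∨-zeroʳ (b =ᵇ a) = refl

record Stable {n} (adj : Fin n → Fin n → Bool) (S : Subset n) : Set where
  constructor mkStable
  field no-edge : ∀ {x y} → lookup S x ≡ true → lookup S y ≡ true → adj x y ≡ false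
open Stable

Independent : ∀ {n} → Subset n → (Fin n → Fin n → Bool) → Subset n → Set
Independent U adj S = S ⊆ U × Stable adj S

Stable-∉ : ∀ {n} {adj : Fin n → Fin n → Bool} {S : Subset n} {x y : Fin n} →
           Stable adj S → lookup S x ≡ true → adj x y ≡ true → lookup S y ≡ false
Stable-∉ stable x∈S xy = ¬-not λ y∈S → not-¬ (no-edge stable x∈S y∈S) xy

Stable-⊆ : ∀ {n} {adj : Fin n → Fin n → Bool} {S T : Subset n} → S ⊆ T → Stable adj T → Stable adj S
Stable-⊆ S⊆T stable = mkStable λ x∈S y∈S → no-edge stable (include S⊆T x∈S) (include S⊆T y∈S)

Stable-insert : ∀ {n} (G : SimpleGraph n) {S : Subset n} {v : Fin n} → Stable (adj G) S →
                (∀ {y} → lookup S y ≡ true → adj G v y ≡ false) → Stable (adj G) (S [ v ]≔ true)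
Stable-insert G {S} {v} stable v-free = mkStable no-edge′
  where
  unchanged : ∀ {x} → x ≢ v → lookup (S [ v ]≔ true) x ≡ true → lookup S x ≡ true
  unchanged x≢v x∈ = trans (≡.sym (lookup-[]≔-≢ S x≢v)) x∈
  no-edge′ : ∀ {x y} → lookup (S [ v ]≔ true) x ≡ true → lookup (S [ v ]≔ true) y ≡ true → adj G x y ≡ false
  no-edge′ {x} {y} x∈ y∈ with x ≟ v | y ≟ v
  ... | yes refl | yes refl = irrfl G x
  ... | yes refl | no y≢v   = v-free (unchanged y≢v y∈)
  ... | no x≢v   | yes refl = trans (SimpleGraph.sym G x y) (v-free (unchanged x≢v x∈))
  ... | no x≢v   | no y≢v   = no-edge stable (unchanged x≢v x∈) (unchanged y≢v y∈)

Stable-addEdge : ∀ {n} {adj : Fin n → Fin n → Bool} {S : Subset n} {a b : Fin n} → Stable adj S →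
                 lookup S a ≡ false ⊎ lookup S b ≡ false → Stable (addEdge adj a b) S
Stable-addEdge {S = S} stable a∉⊎b∉ = mkStable λ x∈ y∈ →
  cong₂ _∨_ (no-edge stable x∈ y∈) (cong₂ _∨_ (not-endpoints a∉⊎b∉ x∈ y∈) (not-endpoints (swap a∉⊎b∉) x∈ y∈))
  where
  not-endpoints : ∀ {a b x y} → lookup S a ≡ false ⊎ lookup S b ≡ false →
                  lookup S x ≡ true → lookup S y ≡ true → x =ᵇ a ∧ y =ᵇ b ≡ false
  not-endpoints {a} {b} {x} {y} a∉⊎b∉ x∈ y∈ with x ≟ a | y ≟ b
  ... | no _     | _        = refl
  ... | yes _    | no _     = refl
  ... | yes refl | yes refl with a∉⊎b∉
  ...   | inj₁ a∉ = ⊥-elim (not-¬ a∉ x∈)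
  ...   | inj₂ b∉ = ⊥-elim (not-¬ b∉ y∈)

Stable-dropEdge : ∀ {n} {adj : Fin n → Fin n → Bool} {S : Subset n} {a b : Fin n} →
                  Stable (addEdge adj a b) S → Stable adj S
Stable-dropEdge {adj = adj} stable = mkStable λ {x} {y} x∈ y∈ → ∨-conicalˡ (adj x y) _ (no-edge stable x∈ y∈)

addEdge-adj : ∀ {n} (adj : Fin n → Fin n → Bool) (a b : Fin n) → addEdge adj a b a b ≡ true
addEdge-adj adj a b rewrite =ᵇ-refl a | =ᵇ-refl b = ∨-zeroʳ (adj a b)

allᵇ⁺ : ∀ {A : Set} {p : A → Bool} (xs : List A) → (∀ x → p x ≡ true) → allᵇ p xs ≡ true
allᵇ⁺ []       _ = refl
allᵇ⁺ (x ∷ xs) h rewrite h x = allᵇ⁺ xs h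

allᵇ⁻ : ∀ {A : Set} {p : A → Bool} {xs : List A} {x : A} → allᵇ p xs ≡ true → x ∈ xs → p x ≡ true
allᵇ⁻ {p = p} {y ∷ _} all x∈ with p y in py
allᵇ⁻ {p = p} {y ∷ _} all (here refl) | true = py
allᵇ⁻ {p = p} {y ∷ _} all (there x∈) | true = allᵇ⁻ all x∈

⇒ᵇ-intro : ∀ {a b : Bool} → (a ≡ true → b ≡ true) → not a ∨ b ≡ true
⇒ᵇ-intro {false} _ = refl
⇒ᵇ-intro {true}  h = h refl

⇒ᵇ-elim : ∀ {a b : Bool} → not a ∨ b ≡ true → a ≡ true → b ≡ true
⇒ᵇ-elim h refl = h

nandᵇ-intro : ∀ {a b c : Bool} → (a ≡ true → b ≡ true → c ≡ false) → not (a ∧ b ∧ c) ≡ true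
nandᵇ-intro {false}                 _ = refl
nandᵇ-intro {true} {false}          _ = refl
nandᵇ-intro {true} {true}  {false}  _ = refl
nandᵇ-intro {true} {true}  {true}   h with h refl refl
... | ()

nandᵇ-elim : ∀ {a b c : Bool} → not (a ∧ b ∧ c) ≡ true → a ≡ true → b ≡ true → c ≡ false
nandᵇ-elim {c = false} _ refl refl = refl

∧-≡-true : ∀ {a b : Bool} → a ∧ b ≡ true → a ≡ true × b ≡ true
∧-≡-true {true} {true} _ = refl , refl

isIndepᵇ-sound : ∀ {n} (U : Subset n) (adj : Fin n → Fin n → Bool) (S : Subset n) →
                 isIndepᵇ U adj S ≡ true → Independent U adj S
isIndepᵇ-sound {n} U adj S isIndep =
  mk⊆ (λ {x} → ⇒ᵇ-elim (allᵇ⁻ {p = inside-at} (proj₁ split) (∈-allFin x))) ,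
  mkStable (λ {x} {y} → nandᵇ-elim (allᵇ⁻ {p = no-edge-at x} (no-edge-from-true x) (∈-allFin y)))
  where
  inside-at : Fin n → Bool
  inside-at x = not (lookup S x) ∨ lookup U x
  no-edge-at : Fin n → Fin n → Bool
  no-edge-at x y = not (lookup S x ∧ lookup S y ∧ adj x y)
  no-edge-from : Fin n → Bool
  no-edge-from x = allᵇ (no-edge-at x) (allFin n)
  split : allᵇ inside-at (allFin n) ≡ true × allᵇ no-edge-from (allFin n) ≡ true
  split = ∧-≡-true isIndep
  no-edge-from-true : ∀ x → no-edge-from x ≡ true
  no-edge-from-true x = allᵇ⁻ {p = no-edge-from} (proj₂ split) (∈-allFin x)

isIndepᵇ-complete : ∀ {n} (U : Subset n) (adj : Fin n → Fin n → Bool) (S : Subset n) →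
                    Independent U adj S → isIndepᵇ U adj S ≡ true
isIndepᵇ-complete {n} U adj S (S⊆U , stable) =
  cong₂ _∧_ (allᵇ⁺ (allFin n) λ _ → ⇒ᵇ-intro (include S⊆U))
            (allᵇ⁺ (allFin n) λ _ → allᵇ⁺ (allFin n) λ _ → nandᵇ-intro (no-edge stable))

foldr-⊔-upper : ∀ {z x : ℚ} {xs : List ℚ} → x ∈ xs → x ≤ List.foldr _⊔_ z xs
foldr-⊔-upper {z} {xs = y ∷ ys} (here refl) = p≤p⊔q y (List.foldr _⊔_ z ys)
foldr-⊔-upper {z} {xs = y ∷ ys} (there x∈) = ≤-trans (foldr-⊔-upper x∈) (p≤q⊔p y (List.foldr _⊔_ z ys))

foldr-⊔-sel : ∀ (z : ℚ) (xs : List ℚ) → List.foldr _⊔_ z xs ≡ z ⊎ List.foldr _⊔_ z xs ∈ xs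
foldr-⊔-sel z []       = inj₁ refl
foldr-⊔-sel z (x ∷ xs) with ⊔-sel x (List.foldr _⊔_ z xs)
... | inj₁ max≡x = inj₂ (here max≡x)
... | inj₂ max≡rest with foldr-⊔-sel z xs
...   | inj₁ rest≡z = inj₁ (trans max≡rest rest≡z)
...   | inj₂ rest∈  = inj₂ (there (≡.subst (_∈ xs) (≡.sym max≡rest) rest∈))

subsets-complete : ∀ n (S : Subset n) → S ∈ subsets n
subsets-complete ℕ.zero    Vec.[]          = here refl
subsets-complete (ℕ.suc n) (true Vec.∷ S)  = ∈-++⁺ˡ (∈-map⁺ (true Vec.∷_) (subsets-complete n S))
subsets-complete (ℕ.suc n) (false Vec.∷ S) =
  ∈-++⁺ʳ (map (true Vec.∷_) (subsets n)) (∈-map⁺ (false Vec.∷_) (subsets-complete n S))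

module _ {n} (U : Subset n) (adj : Fin n → Fin n → Bool) (w : Fin n → ℚ) where

  private
    isIndep? : (S : Subset n) → Dec (isIndepᵇ U adj S ≡ true)
    isIndep? S = isIndepᵇ U adj S Bool.≟ true

  α-upper : ∀ {S} → Independent U adj S → weight w S ≤ α U adj w
  α-upper {S} indep = foldr-⊔-upper (∈-map⁺ (weight w) S∈)
    where
    S∈ : S ∈ filter isIndep? (subsets n)
    S∈ = ∈-filter⁺ isIndep? (subsets-complete n S) (isIndepᵇ-complete U adj S indep)

  α-attained : ∃[ S ] Independent U adj S × α U adj w ≡ weight w S
  α-attained with foldr-⊔-sel 0ℚ (map (weight w) (filter isIndep? (subsets n)))
  ... | inj₁ α≡0 = replicate n false , empty-independent , trans α≡0 (≡.sym (weight-empty w))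
    where
    empty-independent : Independent U adj (replicate n false)
    empty-independent = mk⊆ (λ {x} x∈ → ⊥-elim (not-¬ (lookup-replicate x false) x∈)) ,
                        mkStable (λ {x} x∈ _ → ⊥-elim (not-¬ (lookup-replicate x false) x∈))
  ... | inj₂ α∈ with ∈-map⁻ (weight w) α∈
  ...   | S , S∈ , α≡ = S , isIndepᵇ-sound U adj S (proj₂ (∈-filter⁻ isIndep? {xs = subsets n} S∈)) , α≡

∈-pair : ∀ {A : Set} {x p q : A} → x ∈ p ∷ q ∷ [] → x ≡ p ⊎ x ≡ q
∈-pair (here x≡p)         = inj₁ x≡p
∈-pair (there (here x≡q)) = inj₂ x≡q

length-2-members : ∀ {A : Set} {xs : List A} {a b y : A} → length xs ≡ 2 →
                   a ∈ xs → b ∈ xs → a ≢ b → y ∈ xs → y ≡ a ⊎ y ≡ b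
length-2-members {xs = _ ∷ _ ∷ []} refl a∈ b∈ a≢b y∈ with ∈-pair a∈ | ∈-pair b∈ | ∈-pair y∈
... | inj₁ refl | inj₁ refl | _         = ⊥-elim (a≢b refl)
... | inj₂ refl | inj₂ refl | _         = ⊥-elim (a≢b refl)
... | inj₁ refl | inj₂ refl | inj₁ refl = inj₁ refl
... | inj₁ refl | inj₂ refl | inj₂ refl = inj₂ refl
... | inj₂ refl | inj₁ refl | inj₁ refl = inj₂ refl
... | inj₂ refl | inj₁ refl | inj₂ refl = inj₁ refl

degree-2-neighbours : ∀ {n} {adj : Fin n → Fin n → Bool} {v a b y : Fin n} → degree adj v ≡ 2 →
                      adj v a ≡ true → adj v b ≡ true → a ≢ b → adj v y ≡ true → y ≡ a ⊎ y ≡ b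
degree-2-neighbours {n} {adj} {v} deg va vb a≢b vy =
  length-2-members deg (neighbour va) (neighbour vb) a≢b (neighbour vy)
  where
  neighbour : ∀ {u} → adj v u ≡ true → u ∈ filter (λ u → adj v u Bool.≟ true) (allFin n)
  neighbour {u} vu = ∈-filter⁺ (λ u → adj v u Bool.≟ true) (∈-allFin u) vu

degree-2-free : ∀ {n} {adj : Fin n → Fin n → Bool} {S : Subset n} {v a b : Fin n} → degree adj v ≡ 2 →
                adj v a ≡ true → adj v b ≡ true → a ≢ b → lookup S a ≡ false → lookup S b ≡ false →
                ∀ {y} → lookup S y ≡ true → adj v y ≡ false
degree-2-free {adj = adj} {v = v} deg va vb a≢b a∉S b∉S {y} y∈S with adj v y in vy
... | false = refl
... | true with degree-2-neighbours {adj = adj} deg va vb a≢b vy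
...   | inj₁ refl = ⊥-elim (not-¬ a∉S y∈S)
...   | inj₂ refl = ⊥-elim (not-¬ b∉S y∈S)

edge-contribution-≤ : ∀ {n} {adj : Fin n → Fin n → Bool} (w : Fin n → ℚ) {S : Subset n} {a b : Fin n} →
                      Stable adj S → adj a b ≡ true → 0ℚ ≤ w a → w b ≤ w a →
                      contribution w S b + contribution w S a ≤ w a
edge-contribution-≤ w {S} {a} {b} stable ab 0≤wa wb≤wa with lookup S a in a∈ | lookup S b in b∈
... | true  | true  = ⊥-elim (not-¬ (no-edge stable a∈ b∈) ab)
... | true  | false = ≤-reflexive (+-identityˡ (w a))
... | false | true  = ≤-trans (≤-reflexive (+-identityʳ (w b))) wb≤wa
... | false | false = 0≤wa

weight-delete-edge : ∀ {n} {adj : Fin n → Fin n → Bool} (w : Fin n → ℚ) {S : Subset n} {a b : Fin n} →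
                     Stable adj S → adj a b ≡ true → a ≢ b → 0ℚ ≤ w a → w b ≤ w a →
                     weight w S ≤ weight w (S [ a ]≔ false [ b ]≔ false) + w a
weight-delete-edge w {S} {a} {b} stable ab a≢b 0≤wa wb≤wa = begin
  weight w S                                               ≡⟨ weight-remove w S a ⟩
  weight w S₁ + contribution w S a                          ≡⟨ cong (_+ contribution w S a) (weight-remove w S₁ b) ⟩
  (weight w S₂ + contribution w S₁ b) + contribution w S a  ≡⟨ cong (λ c → (weight w S₂ + c) + _) b-unchanged ⟩
  (weight w S₂ + contribution w S b) + contribution w S a   ≡⟨ +-assoc (weight w S₂) _ _ ⟩
  weight w S₂ + (contribution w S b + contribution w S a)   ≤⟨ +-monoʳ-≤ (weight w S₂) ends≤wa ⟩
  weight w S₂ + w a                                         ∎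
  where
  open ≤-Reasoning
  S₁ S₂ : Subset _
  S₁ = S [ a ]≔ false
  S₂ = S₁ [ b ]≔ false
  b-unchanged : contribution w S₁ b ≡ contribution w S b
  b-unchanged = cong (λ c → if c then w b else 0ℚ) (lookup-[]≔-≢ S (a≢b ∘ ≡.sym))
  ends≤wa : contribution w S b + contribution w S a ≤ w a
  ends≤wa = edge-contribution-≤ w stable ab 0≤wa wb≤wa

module PathReduction {n} (G : SimpleGraph n) (w : Fin n → ℚ) {v₁ v₂ v₃ v₄ : Fin n}
                     (e₁₂ : adj G v₁ v₂ ≡ true) (e₂₃ : adj G v₂ v₃ ≡ true) (e₃₄ : adj G v₃ v₄ ≡ true) where

  adj′ : Fin n → Fin n → Bool
  adj′ = addEdge (adj G) v₁ v₄

  U′ : Subset n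
  U′ = removeTwo v₂ v₃

  w′ : Fin n → ℚ
  w′ = newWeight w v₁ v₂ v₃

  module Deletion (v₁≢v₃ : v₁ ≢ v₃) (v₁≢v₄ : v₁ ≢ v₄) (v₂≢v₃ : v₂ ≢ v₃) (v₃≢v₄ : v₃ ≢ v₄)
                  (0≤w₃ : 0ℚ ≤ w v₃) (w₃≤w₂ : w v₃ ≤ w v₂) (w₄≤w₃ : w v₄ ≤ w v₃)
                  {S : Subset n} (stable : Stable (adj G) S) where

    delete-v₂v₃ : lookup S v₁ ≡ false → ∃[ S′ ] Independent U′ adj′ S′ × weight w S ≤ weight w′ S′ + w v₂
    delete-v₂v₃ v₁∉S = S′ , (⊆-removeTwo v₂∉S′ v₃∉S′ , Stable-addEdge (Stable-⊆ S′⊆S stable) (inj₁ v₁∉S′)) , (begin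
      weight w S           ≤⟨ weight-delete-edge w stable e₂₃ v₂≢v₃ (≤-trans 0≤w₃ w₃≤w₂) w₃≤w₂ ⟩
      weight w S′ + w v₂   ≡⟨ cong (_+ w v₂) (weight-newWeight-∉ w v₁ v₂ v₃ S′ v₁∉S′) ⟨
      weight w′ S′ + w v₂  ∎)
      where
      open ≤-Reasoning
      S′ : Subset n
      S′ = S [ v₂ ]≔ false [ v₃ ]≔ false
      S′⊆S : S′ ⊆ S
      S′⊆S = ⊆-trans ([]≔false-⊆ (S [ v₂ ]≔ false) v₃) ([]≔false-⊆ S v₂)
      v₁∉S′ : lookup S′ v₁ ≡ false
      v₁∉S′ = ⊆-∉ S′⊆S v₁∉S
      v₂∉S′ : lookup S′ v₂ ≡ false
      v₂∉S′ = trans (lookup-[]≔-≢ (S [ v₂ ]≔ false) v₂≢v₃) (lookup-[]≔ S v₂)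
      v₃∉S′ : lookup S′ v₃ ≡ false
      v₃∉S′ = lookup-[]≔ (S [ v₂ ]≔ false) v₃

    delete-v₃v₄ : lookup S v₁ ≡ true → ∃[ S′ ] Independent U′ adj′ S′ × weight w S ≤ weight w′ S′ + w v₂
    delete-v₃v₄ v₁∈S = S′ , (⊆-removeTwo v₂∉S′ v₃∉S′ , Stable-addEdge (Stable-⊆ S′⊆S stable) (inj₂ v₄∉S′)) , (begin
      weight w S           ≤⟨ weight-delete-edge w stable e₃₄ v₃≢v₄ 0≤w₃ w₄≤w₃ ⟩
      weight w S′ + w v₃   ≡⟨ weight-newWeight-∈ w v₁ v₂ v₃ S′ v₁∈S′ ⟨
      weight w′ S′ + w v₂  ∎)
      where
      open ≤-Reasoning
      S′ : Subset n
      S′ = S [ v₃ ]≔ false [ v₄ ]≔ false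
      S′⊆S : S′ ⊆ S
      S′⊆S = ⊆-trans ([]≔false-⊆ (S [ v₃ ]≔ false) v₄) ([]≔false-⊆ S v₃)
      v₁∈S′ : lookup S′ v₁ ≡ true
      v₁∈S′ = trans (lookup-[]≔-≢ (S [ v₃ ]≔ false) v₁≢v₄) (trans (lookup-[]≔-≢ S v₁≢v₃) v₁∈S)
      v₂∉S′ : lookup S′ v₂ ≡ false
      v₂∉S′ = ⊆-∉ S′⊆S (Stable-∉ stable v₁∈S e₁₂)
      v₃∉S′ : lookup S′ v₃ ≡ false
      v₃∉S′ = trans (lookup-[]≔-≢ (S [ v₃ ]≔ false) v₃≢v₄) (lookup-[]≔ S v₃)
      v₄∉S′ : lookup S′ v₄ ≡ false
      v₄∉S′ = lookup-[]≔ (S [ v₃ ]≔ false) v₄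

    delete-path : ∃[ S′ ] Independent U′ adj′ S′ × weight w S ≤ weight w′ S′ + w v₂
    delete-path with lookup S v₁ in v₁∈?
    ... | false = delete-v₂v₃ v₁∈?
    ... | true  = delete-v₃v₄ v₁∈?

  module Extension (v₁≢v₃ : v₁ ≢ v₃) (v₂≢v₄ : v₂ ≢ v₄)
                   (deg₂ : degree (adj G) v₂ ≡ 2) (deg₃ : degree (adj G) v₃ ≡ 2)
                   {T : Subset n} (T⊆U′ : T ⊆ U′) (stable′ : Stable adj′ T) where

    private
      stable : Stable (adj G) T
      stable = Stable-dropEdge stable′

      v₂∉T : lookup T v₂ ≡ false
      v₂∉T = ⊆-∉ T⊆U′ (removeTwo-∌ˡ v₂ v₃)

      v₃∉T : lookup T v₃ ≡ false
      v₃∉T = ⊆-∉ T⊆U′ (removeTwo-∌ʳ v₂ v₃)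

    add-v₃ : lookup T v₁ ≡ true → ∃[ S ] Independent full (adj G) S × weight w′ T + w v₂ ≡ weight w S
    add-v₃ v₁∈T = T [ v₃ ]≔ true , (⊆-full , Stable-insert G stable v₃-free) , (begin
      weight w′ T + w v₂          ≡⟨ weight-newWeight-∈ w v₁ v₂ v₃ T v₁∈T ⟩
      weight w T + w v₃           ≡⟨ weight-insert w T v₃∉T ⟨
      weight w (T [ v₃ ]≔ true)   ∎)
      where
      open ≡.≡-Reasoning
      v₃-free : ∀ {y} → lookup T y ≡ true → adj G v₃ y ≡ false
      v₃-free = degree-2-free {adj = adj G} {S = T} deg₃ (trans (SimpleGraph.sym G v₃ v₂) e₂₃) e₃₄ v₂≢v₄
                              v₂∉T (Stable-∉ stable′ v₁∈T (addEdge-adj (adj G) v₁ v₄))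

    add-v₂ : lookup T v₁ ≡ false → ∃[ S ] Independent full (adj G) S × weight w′ T + w v₂ ≡ weight w S
    add-v₂ v₁∉T = T [ v₂ ]≔ true , (⊆-full , Stable-insert G stable v₂-free) , (begin
      weight w′ T + w v₂          ≡⟨ cong (_+ w v₂) (weight-newWeight-∉ w v₁ v₂ v₃ T v₁∉T) ⟩
      weight w T + w v₂           ≡⟨ weight-insert w T v₂∉T ⟨
      weight w (T [ v₂ ]≔ true)   ∎)
      where
      open ≡.≡-Reasoning
      v₂-free : ∀ {y} → lookup T y ≡ true → adj G v₂ y ≡ false
      v₂-free = degree-2-free {adj = adj G} {S = T} deg₂ (trans (SimpleGraph.sym G v₂ v₁) e₁₂) e₂₃ v₁≢v₃
                              v₁∉T v₃∉T

    extend-path : ∃[ S ] Independent full (adj G) S × weight w′ T + w v₂ ≡ weight w S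
    extend-path with lookup T v₁ in v₁∈?
    ... | false = add-v₂ v₁∈?
    ... | true  = add-v₃ v₁∈?

lemma4 : ∀ {n} (G : SimpleGraph n) (w : Fin n → ℚ)
             → (∀ v → 0ℚ < w v)
             → (v₁ v₂ v₃ v₄ : Fin n)
             → v₁ ≢ v₂ → v₁ ≢ v₃ → v₁ ≢ v₄ → v₂ ≢ v₃ → v₂ ≢ v₄ → v₃ ≢ v₄
             → adj G v₁ v₂ ≡ true → adj G v₂ v₃ ≡ true → adj G v₃ v₄ ≡ true
             → degree (adj G) v₂ ≡ 2 → degree (adj G) v₃ ≡ 2
             → w v₂ ≤ w v₁ → w v₃ ≤ w v₂ → w v₄ ≤ w v₃
             → α full (adj G) w
               ≡ α (removeTwo v₂ v₃) (addEdge (adj G) v₁ v₄) (newWeight w v₁ v₂ v₃) + w v₂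
lemma4 G w pos v₁ v₂ v₃ v₄ _ v₁≢v₃ v₁≢v₄ v₂≢v₃ v₂≢v₄ v₃≢v₄ e₁₂ e₂₃ e₃₄ deg₂ deg₃ _ w₃≤w₂ w₄≤w₃ =
  ≤-antisym α≤α′+w₂ α′+w₂≤α
  where
  open PathReduction G w e₁₂ e₂₃ e₃₄
  open ≤-Reasoning

  α≤α′+w₂ : α full (adj G) w ≤ α U′ adj′ w′ + w v₂
  α≤α′+w₂ with α-attained full (adj G) w
  ... | S , (_ , stable) , α≡ with Deletion.delete-path v₁≢v₃ v₁≢v₄ v₂≢v₃ v₃≢v₄ (<⇒≤ (pos v₃)) w₃≤w₂ w₄≤w₃ stable
  ...   | S′ , indep′ , loss = begin
    α full (adj G) w       ≡⟨ α≡ ⟩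
    weight w S            ≤⟨ loss ⟩
    weight w′ S′ + w v₂    ≤⟨ +-monoˡ-≤ (w v₂) (α-upper U′ adj′ w′ indep′) ⟩
    α U′ adj′ w′ + w v₂    ∎

  α′+w₂≤α : α U′ adj′ w′ + w v₂ ≤ α full (adj G) w
  α′+w₂≤α with α-attained U′ adj′ w′
  ... | T , (T⊆U′ , stable′) , α′≡ with Extension.extend-path v₁≢v₃ v₂≢v₄ deg₂ deg₃ T⊆U′ stable′
  ...   | S , indep , gain = begin
    α U′ adj′ w′ + w v₂    ≡⟨ cong (_+ w v₂) α′≡ ⟩
    weight w′ T + w v₂     ≡⟨ gain ⟩
    weight w S            ≤⟨ α-upper full (adj G) w indep ⟩
    α full (adj G) w       ∎
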